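{- Let $G$ be a finite loop-free multigraph whose degree sequence is graphical. Then $G$ can be transformed into a simple graph by a finite sequence of admissible double edge swaps.
   Context: A loop-free multigraph is a finite undirected graph without loops in which several edges may join the same pair of distinct vertices. The type of an edge joining $u$ and $v$ is the unordered pair $\{u,v\}$, and the multiplicity of $\{u,v\}$ is the number of edges of that type. An edge is simple if it is not a loop and its type has multiplicity one; a graph is simple if all its edges are simple. The degree of a vertex is the number of half-edges attached to it, and the degree sequence is the list of degrees sorted in weakly decreasing order. A weakly decreasing sequence is graphical if it is the degree sequence of some simple graph. Given two distinct edges of types $\{v_1,v_2\}$ and $\{v_3,v_4\}$, the double edge swap $(v_1,v_2)(v_3,v_4)$ removes these two edges and adds an edge of type $\{v_2,v_3\}$ and an edge of type $\{v_4,v_1\}$. The swap is admissible if the two removed edges share no endpoint and not both of them are simple (before the swap). -}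

module Defs where

open import Data.Nat using (ℕ; zero; suc; _+_)
open import Data.Nat.Properties using (≤-decTotalOrder)
open import Data.Fin using (Fin) renaming (_≟_ to _≟ᶠ_)
open import Data.Fin.Properties using ()
open import Data.List using (List; []; _∷_; _++_; map; filter; length; lookup; allFin)
open import Data.Nat.ListAction using (sum)
open import Data.List.Relation.Unary.All using (All)
open import Data.Product using (_×_; _,_; proj₁; proj₂; ∃-syntax)
open import Data.Sum using (_⊎_)
open import Data.Bool using (Bool; true; false)
open import Relation.Nullary using (¬_; Dec; yes; no)
open import Relation.Nullary.Decidable using (_×-dec_; _⊎-dec_; ¬?)
open import Relation.Binary.PropositionalEquality using (_≡_; _≢_)
open import Relation.Binary.Construct.Closure.ReflexiveTransitive using (Star)
import Relation.Binary.Construct.Flip.EqAndOrd as Flip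
import Data.List.Sort.MergeSort as MergeSort
open import Data.List.Sort.Base using (SortingAlgorithm)

-- An edge on the vertex set Fin n is a pair of endpoints; its type is
-- the unordered pair of endpoints.
Edge : ℕ → Set
Edge n = Fin n × Fin n

-- A (multi)graph on the vertex set Fin n: a finite list of edges
-- (a multiset; several edges may have the same type).
Graph : ℕ → Set
Graph n = List (Edge n)

IsLoop : ∀ {n} → Edge n → Set
IsLoop (u , v) = u ≡ v

LoopFree : ∀ {n} → Graph n → Set
LoopFree G = All (λ e → ¬ IsLoop e) G

SameType : ∀ {n} → Edge n → Edge n → Set
SameType (a , b) (c , d) = (a ≡ c × b ≡ d) ⊎ (a ≡ d × b ≡ c)

sameType? : ∀ {n} (e f : Edge n) → Dec (SameType e f)
sameType? (a , b) (c , d) = ((a ≟ᶠ c) ×-dec (b ≟ᶠ d)) ⊎-dec ((a ≟ᶠ d) ×-dec (b ≟ᶠ c))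

multiplicity : ∀ {n} → Graph n → Edge n → ℕ
multiplicity G e = length (filter (sameType? e) G)

SimpleEdge : ∀ {n} → Graph n → Edge n → Set
SimpleEdge G e = ¬ IsLoop e × multiplicity G e ≡ 1

SimpleGraph : ∀ {n} → Graph n → Set
SimpleGraph G = All (SimpleEdge G) G

ind : ∀ {n} → Fin n → Fin n → ℕ
ind u v with u ≟ᶠ v
... | yes _ = 1
... | no _  = 0

degree : ∀ {n} → Graph n → Fin n → ℕ
degree G v = sum (map (λ e → ind (proj₁ e) v + ind (proj₂ e) v) G)

open MergeSort (Flip.decTotalOrder ≤-decTotalOrder) using (mergeSort)

sortDecreasing : List ℕ → List ℕ
sortDecreasing = SortingAlgorithm.sort mergeSort

degreeSequence : ∀ {n} → Graph n → List ℕ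
degreeSequence {n} G = sortDecreasing (map (degree G) (allFin n))

Graphical : List ℕ → Set
Graphical ds = ∃[ n ] ∃[ H ] (SimpleGraph {n} H × degreeSequence H ≡ ds)

orient : ∀ {n} → Bool → Edge n → Edge n
orient false e = e
orient true (u , v) = (v , u)

removeTwo : ∀ {n} (G : Graph n) → Fin (length G) → Fin (length G) → Graph n
removeTwo G i j =
  map (lookup G) (filter (λ k → ¬? (k ≟ᶠ i) ×-dec ¬? (k ≟ᶠ j)) (allFin (length G)))

Disjoint : ∀ {n} → Edge n → Edge n → Set
Disjoint (a , b) (c , d) = a ≢ c × a ≢ d × b ≢ c × b ≢ d

AdmissibleSwap : ∀ {n} → Graph n → Graph n → Set
AdmissibleSwap G G' =
  ∃[ i ] ∃[ j ] ∃[ s ] ∃[ t ]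
    let (v₁ , v₂) = orient s (lookup G i)
        (v₃ , v₄) = orient t (lookup G j) in
    i ≢ j
    × Disjoint (v₁ , v₂) (v₃ , v₄)
    × ¬ (SimpleEdge G (lookup G i) × SimpleEdge G (lookup G j))
    × G' ≡ (v₂ , v₃) ∷ (v₄ , v₁) ∷ removeTwo G i j

SwapReachable : ∀ {n} → Graph n → Graph n → Set
SwapReachable = Star AdmissibleSwap

module Submission where

-- Fix a simple graph H with the degree sequence of G, relabelled so that every vertex v of G has the
-- degree of its image, and let h be its adjacency matrix. Measure G by the distance
-- Σ_{p,q} |m_G(p,q) − h(p,q)| of its multiplicity matrix from h. If G is not simple it has a multiple
-- edge ab, so m(a,b) > h(a,b). Whenever some u and x ≠ a have m(b,u) < h(b,u) and m(u,x) > h(u,x), the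
-- admissible swap (a,b)(u,x) removes edges of the excess types ab, ux, adds one of the missing type bu
-- and one of type xa, and so strictly decreases the distance. Otherwise every type bq missing from G
-- forces the excess type aq (the excess at q has nowhere else to go), hence deficit(b) < surplus(a);
-- surplus and deficit at a vertex agree because G and h have the same degrees. The same argument for
-- the orientation ba gives deficit(a) < deficit(b), which is absurd.

open import Defs
open import Data.Nat using (ℕ; zero; suc; _+_; _*_; _∸_; _≤_; _<_; z≤n; s≤s; ∣_-_∣; _≟_; _<?_)
open import Data.Nat.Properties
open import Data.Nat.ListAction using (sum)
open import Data.Nat.Induction using (<-wellFounded)
open import Data.Nat.Tactic.RingSolver using (solve-∀)
open import Data.Fin using (Fin; zero; suc; cast) renaming (_≟_ to _≟ᶠ_)
open import Data.Fin.Properties using (any?; cast-involutive) renaming (suc-injective to Fin-suc-injective)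
import Data.Fin.Permutation as Perm
open import Data.Fin.Permutation using (_⟨$⟩ʳ_)
open import Data.List using (List; []; _∷_; map; filter; length; lookup; allFin; tabulate)
open import Data.List.Properties using (map-tabulate; tabulate-lookup; map-∘; length-tabulate)
open import Data.List.Relation.Unary.All using (All; []; _∷_)
import Data.List.Relation.Unary.All as All
import Data.List.Relation.Unary.All.Properties as All
import Data.List.Relation.Unary.Any as Any
import Data.List.Relation.Unary.Any.Properties as Any
open import Data.List.Membership.Propositional.Properties using (∈-lookup)
import Data.List.Relation.Binary.Permutation.Homogeneous as Homogeneous
import Data.List.Relation.Binary.Permutation.Setoid as SetoidPermutation
import Data.List.Relation.Binary.Permutation.Setoid.Properties as SetoidPermutationProperties
import Data.List.Sort.MergeSort as MergeSort
open import Data.List.Sort.Base using (SortingAlgorithm)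
open import Data.Product using (_×_; _,_; proj₁; proj₂; ∃-syntax; Σ-syntax)
open import Data.Sum using (_⊎_; inj₁; inj₂)
open import Data.Bool using (Bool; true; false)
open import Data.Empty using (⊥-elim)
open import Function using (_∘_)
open import Induction.WellFounded using (Acc; acc)
open import Relation.Nullary using (¬_; Dec; yes; no)
open import Relation.Nullary.Decidable using (_×-dec_; ¬?; decidable-stable)
open import Relation.Unary using (Pred; Decidable)
open import Relation.Binary.PropositionalEquality
import Relation.Binary.PropositionalEquality as ≡
import Relation.Binary.Construct.Flip.EqAndOrd as Flip
open import Relation.Binary.Construct.Closure.ReflexiveTransitive using (ε; _◅_)
open import Algebra.Properties.CommutativeMonoid.Sum +-0-commutativeMonoid
  using (sum-syntax; sum-cong-≗; ∑-distrib-+; ∑-permute)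

open MergeSort (Flip.decTotalOrder ≤-decTotalOrder) using (mergeSort)

χ : ∀ {p} {P : Set p} → Dec P → ℕ
χ (yes _) = 1
χ (no _)  = 0

χ-yes : ∀ {p} {P : Set p} (d : Dec P) → P → χ d ≡ 1
χ-yes (yes _) _ = refl
χ-yes (no ¬p) p = ⊥-elim (¬p p)

χ-no : ∀ {p} {P : Set p} (d : Dec P) → ¬ P → χ d ≡ 0
χ-no (yes p) ¬p = ⊥-elim (¬p p)
χ-no (no _)  _  = refl

χ-cong : ∀ {p q} {P : Set p} {Q : Set q} → (P → Q) → (Q → P) → (d : Dec P) (e : Dec Q) → χ d ≡ χ e
χ-cong f g (yes p) (yes q) = refl
χ-cong f g (yes p) (no ¬q) = ⊥-elim (¬q (f p))
χ-cong f g (no ¬p) (yes q) = ⊥-elim (¬p (g q))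
χ-cong f g (no ¬p) (no ¬q) = refl

∑-mono-≤ : ∀ {n} {f g : Fin n → ℕ} → (∀ i → f i ≤ g i) → ∑[ i < n ] f i ≤ ∑[ i < n ] g i
∑-mono-≤ {zero}  f≤g = z≤n
∑-mono-≤ {suc n} f≤g = +-mono-≤ (f≤g zero) (∑-mono-≤ (f≤g ∘ suc))

∑-zero : ∀ {n} {f : Fin n → ℕ} → (∀ i → f i ≡ 0) → ∑[ i < n ] f i ≡ 0
∑-zero {zero}  f≡0 = refl
∑-zero {suc n} f≡0 = cong₂ _+_ (f≡0 zero) (∑-zero (f≡0 ∘ suc))

∑-supported : ∀ {n} {f : Fin n → ℕ} (a : Fin n) → (∀ i → i ≢ a → f i ≡ 0) → ∑[ i < n ] f i ≡ f a
∑-supported {f = f} zero    f≡0 = trans (cong (f zero +_) (∑-zero (λ i → f≡0 (suc i) λ ()))) (+-identityʳ _)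
∑-supported {f = f} (suc a) f≡0 =
  cong₂ _+_ (f≡0 zero λ ()) (∑-supported a (λ i i≢a → f≡0 (suc i) (i≢a ∘ Fin-suc-injective)))

∑-indicator : ∀ {n} (a : Fin n) → ∑[ i < n ] χ (i ≟ᶠ a) ≡ 1
∑-indicator a = trans (∑-supported a (λ i i≢a → χ-no (i ≟ᶠ a) i≢a)) (χ-yes (a ≟ᶠ a) refl)

∑-point-weight : ∀ {n} (c : Fin n → ℕ) (a : Fin n) → ∑[ k < n ] (χ (k ≟ᶠ a) * c k) ≡ c a
∑-point-weight c a =
  trans (∑-supported a (λ k k≢a → cong (_* c k) (χ-no (k ≟ᶠ a) k≢a)))
        (trans (cong (_* c a) (χ-yes (a ≟ᶠ a) refl)) (+-identityʳ (c a)))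

term≤∑ : ∀ {n} (f : Fin n → ℕ) (a : Fin n) → f a ≤ ∑[ i < n ] f i
term≤∑ f zero    = m≤m+n _ _
term≤∑ f (suc a) = ≤-trans (term≤∑ (f ∘ suc) a) (m≤n+m _ _)

χ-partition : ∀ {n} {i j : Fin n} → i ≢ j → ∀ k →
  χ (k ≟ᶠ i) + χ (k ≟ᶠ j) + χ (¬? (k ≟ᶠ i) ×-dec ¬? (k ≟ᶠ j)) ≡ 1
χ-partition {i = i} {j} i≢j k with k ≟ᶠ i | k ≟ᶠ j
... | yes refl | yes refl = ⊥-elim (i≢j refl)
... | yes _    | no _     = refl
... | no _     | yes _    = refl
... | no _     | no _     = refl

∑-split-two : ∀ {N} (c : Fin N → ℕ) {i j : Fin N} → i ≢ j →
  c i + c j + ∑[ k < N ] (χ (¬? (k ≟ᶠ i) ×-dec ¬? (k ≟ᶠ j)) * c k) ≡ ∑[ k < N ] c k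
∑-split-two {N} c {i} {j} i≢j = begin
  c i + c j + ∑[ k < N ] (χ (Q? k) * c k)
    ≡⟨ cong₂ (λ x y → x + y + ∑[ k < N ] (χ (Q? k) * c k)) (∑-point-weight c i) (∑-point-weight c j) ⟨
  ∑[ k < N ] (χ (k ≟ᶠ i) * c k) + ∑[ k < N ] (χ (k ≟ᶠ j) * c k) + ∑[ k < N ] (χ (Q? k) * c k)
    ≡⟨ cong (_+ ∑[ k < N ] (χ (Q? k) * c k)) (∑-distrib-+ (λ k → χ (k ≟ᶠ i) * c k) (λ k → χ (k ≟ᶠ j) * c k)) ⟨
  ∑[ k < N ] (χ (k ≟ᶠ i) * c k + χ (k ≟ᶠ j) * c k) + ∑[ k < N ] (χ (Q? k) * c k)
    ≡⟨ ∑-distrib-+ (λ k → χ (k ≟ᶠ i) * c k + χ (k ≟ᶠ j) * c k) (λ k → χ (Q? k) * c k) ⟨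
  ∑[ k < N ] (χ (k ≟ᶠ i) * c k + χ (k ≟ᶠ j) * c k + χ (Q? k) * c k)
    ≡⟨ sum-cong-≗ split ⟩
  ∑[ k < N ] c k ∎
  where
  open ≡-Reasoning
  Q? : ∀ k → Dec (¬ k ≡ i × ¬ k ≡ j)
  Q? k = ¬? (k ≟ᶠ i) ×-dec ¬? (k ≟ᶠ j)
  split : ∀ k → χ (k ≟ᶠ i) * c k + χ (k ≟ᶠ j) * c k + χ (Q? k) * c k ≡ c k
  split k = begin
    χ (k ≟ᶠ i) * c k + χ (k ≟ᶠ j) * c k + χ (Q? k) * c k
      ≡⟨ cong (_+ χ (Q? k) * c k) (*-distribʳ-+ (c k) (χ (k ≟ᶠ i)) (χ (k ≟ᶠ j))) ⟨
    (χ (k ≟ᶠ i) + χ (k ≟ᶠ j)) * c k + χ (Q? k) * c k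
      ≡⟨ *-distribʳ-+ (c k) (χ (k ≟ᶠ i) + χ (k ≟ᶠ j)) (χ (Q? k)) ⟨
    (χ (k ≟ᶠ i) + χ (k ≟ᶠ j) + χ (Q? k)) * c k
      ≡⟨ cong (_* c k) (χ-partition i≢j k) ⟩
    1 * c k
      ≡⟨ *-identityˡ (c k) ⟩
    c k ∎

∑∑ : ∀ {n} → (Fin n → Fin n → ℕ) → ℕ
∑∑ {n} f = ∑[ p < n ] ∑[ q < n ] f p q

∑∑-distrib-+ : ∀ {n} (f g : Fin n → Fin n → ℕ) → ∑∑ (λ p q → f p q + g p q) ≡ ∑∑ f + ∑∑ g
∑∑-distrib-+ f g = trans (sum-cong-≗ (λ p → ∑-distrib-+ (f p) (g p))) (∑-distrib-+ (λ p → ∑[ q < _ ] f p q) _)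

sum-map-tabulate : ∀ {A : Set} {n} (w : A → ℕ) (f : Fin n → A) → sum (map w (tabulate f)) ≡ ∑[ i < n ] w (f i)
sum-map-tabulate {n = zero}  w f = refl
sum-map-tabulate {n = suc n} w f = cong (w (f zero) +_) (sum-map-tabulate w (f ∘ suc))

sum-map-lookup : ∀ {A : Set} (w : A → ℕ) (xs : List A) → sum (map w xs) ≡ ∑[ k < length xs ] w (lookup xs k)
sum-map-lookup w xs = trans (cong (sum ∘ map w) (sym (tabulate-lookup xs))) (sum-map-tabulate w (lookup xs))

sum-map-filter : ∀ {A : Set} {p} {Q : Pred A p} (Q? : Decidable Q) (w : A → ℕ) (xs : List A) →
  sum (map w (filter Q? xs)) ≡ sum (map (λ x → χ (Q? x) * w x) xs)
sum-map-filter Q? w [] = refl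
sum-map-filter Q? w (x ∷ xs) with Q? x
... | yes _ = cong₂ _+_ (sym (+-identityʳ (w x))) (sum-map-filter Q? w xs)
... | no  _ = sum-map-filter Q? w xs

count : ∀ {A : Set} {p} {P : Pred A p} → Decidable P → List A → ℕ
count P? xs = length (filter P? xs)

count-∷ : ∀ {A : Set} {p} {P : Pred A p} (P? : Decidable P) (x : A) (xs : List A) →
  count P? (x ∷ xs) ≡ χ (P? x) + count P? xs
count-∷ P? x xs with P? x
... | yes _ = refl
... | no  _ = refl

count≡sum : ∀ {A : Set} {p} {P : Pred A p} (P? : Decidable P) (xs : List A) → count P? xs ≡ sum (map (χ ∘ P?) xs)
count≡sum P? [] = refl
count≡sum P? (x ∷ xs) with P? x
... | yes _ = cong suc (count≡sum P? xs)
... | no  _ = count≡sum P? xs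

sum-map-removeTwo : ∀ {n} (w : Edge n → ℕ) (G : Graph n) {i j : Fin (length G)} → i ≢ j →
  w (lookup G i) + w (lookup G j) + sum (map w (removeTwo G i j)) ≡ sum (map w G)
sum-map-removeTwo w G {i} {j} i≢j = begin
  c i + c j + sum (map w (map (lookup G) (filter Q? (allFin N))))
    ≡⟨ cong (λ l → c i + c j + sum l) (map-∘ (filter Q? (allFin N))) ⟨
  c i + c j + sum (map c (filter Q? (allFin N)))
    ≡⟨ cong (c i + c j +_) (sum-map-filter Q? c (allFin N)) ⟩
  c i + c j + sum (map (λ k → χ (Q? k) * c k) (allFin N))
    ≡⟨ cong (c i + c j +_) (sum-map-tabulate (λ k → χ (Q? k) * c k) (λ k → k)) ⟩
  c i + c j + ∑[ k < N ] (χ (Q? k) * c k)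
    ≡⟨ ∑-split-two c i≢j ⟩
  ∑[ k < N ] c k
    ≡⟨ sum-map-lookup w G ⟨
  sum (map w G) ∎
  where
  open ≡-Reasoning
  N = length G
  c : Fin N → ℕ
  c = w ∘ lookup G
  Q? : ∀ k → Dec (¬ k ≡ i × ¬ k ≡ j)
  Q? k = ¬? (k ≟ᶠ i) ×-dec ¬? (k ≟ᶠ j)

All-removeTwo : ∀ {n} {P : Edge n → Set} {G : Graph n} → All P G → ∀ i j → All P (removeTwo G i j)
All-removeTwo all i j = All.map⁺ (All.universal (λ k → All.lookup all (∈-lookup k)) _)

SameType-refl : ∀ {n} (e : Edge n) → SameType e e
SameType-refl _ = inj₁ (refl , refl)

SameType-sym : ∀ {n} {e f : Edge n} → SameType e f → SameType f e
SameType-sym (inj₁ (refl , refl)) = inj₁ (refl , refl)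
SameType-sym (inj₂ (refl , refl)) = inj₂ (refl , refl)

SameType-trans : ∀ {n} {e f g : Edge n} → SameType e f → SameType f g → SameType e g
SameType-trans (inj₁ (refl , refl)) s = s
SameType-trans (inj₂ (refl , refl)) (inj₁ (refl , refl)) = inj₂ (refl , refl)
SameType-trans (inj₂ (refl , refl)) (inj₂ (refl , refl)) = inj₁ (refl , refl)

SameType-common : ∀ {n} {e f g : Edge n} → SameType e f → SameType e g → SameType f g
SameType-common e~f e~g = SameType-trans (SameType-sym e~f) e~g

SameType-flip : ∀ {n} (a b : Fin n) → SameType (a , b) (b , a)
SameType-flip _ _ = inj₂ (refl , refl)

SameType-orient : ∀ {n} (s : Bool) (e : Edge n) → SameType (orient s e) e
SameType-orient false e       = SameType-refl e
SameType-orient true  (a , b) = SameType-flip b a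

SameType-of-orient : ∀ {n} {t : Bool} {e f : Edge n} → orient t e ≡ f → SameType f e
SameType-of-orient {t = t} {e} refl = SameType-orient t e

¬SameType-fst : ∀ {n} {a b c d : Fin n} → a ≢ c → a ≢ d → ¬ SameType (a , b) (c , d)
¬SameType-fst a≢c a≢d (inj₁ (a≡c , _)) = a≢c a≡c
¬SameType-fst a≢c a≢d (inj₂ (a≡d , _)) = a≢d a≡d

¬SameType-snd : ∀ {n} {a b c d : Fin n} → b ≢ c → b ≢ d → ¬ SameType (a , b) (c , d)
¬SameType-snd b≢c b≢d (inj₁ (_ , b≡d)) = b≢d b≡d
¬SameType-snd b≢c b≢d (inj₂ (_ , b≡c)) = b≢c b≡c

sameTypeχ : ∀ {n} → Edge n → Edge n → ℕ
sameTypeχ e f = χ (sameType? e f)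

sameTypeχ-congʳ : ∀ {n} (e : Edge n) {f f′ : Edge n} → SameType f f′ → sameTypeχ e f ≡ sameTypeχ e f′
sameTypeχ-congʳ e f~f′ =
  χ-cong (λ s → SameType-trans s f~f′) (λ s → SameType-trans s (SameType-sym f~f′)) _ _

sameTypeχ-congˡ : ∀ {n} (f : Edge n) {e e′ : Edge n} → SameType e e′ → sameTypeχ e f ≡ sameTypeχ e′ f
sameTypeχ-congˡ f e~e′ = χ-cong (SameType-trans (SameType-sym e~e′)) (SameType-trans e~e′) _ _

multiplicity-∷ : ∀ {n} (x : Edge n) (G : Graph n) (e : Edge n) →
  multiplicity (x ∷ G) e ≡ sameTypeχ e x + multiplicity G e
multiplicity-∷ x G e = count-∷ (sameType? e) x G

multiplicity-cong : ∀ {n} (G : Graph n) {e e′ : Edge n} → SameType e e′ → multiplicity G e ≡ multiplicity G e′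
multiplicity-cong [] e~e′ = refl
multiplicity-cong (x ∷ G) {e} {e′} e~e′ = begin
  multiplicity (x ∷ G) e              ≡⟨ multiplicity-∷ x G e ⟩
  sameTypeχ e x + multiplicity G e    ≡⟨ cong₂ _+_ (sameTypeχ-congˡ x e~e′) (multiplicity-cong G e~e′) ⟩
  sameTypeχ e′ x + multiplicity G e′  ≡⟨ multiplicity-∷ x G e′ ⟨
  multiplicity (x ∷ G) e′             ∎
  where open ≡-Reasoning

multiplicity-flip : ∀ {n} (G : Graph n) (p q : Fin n) → multiplicity G (p , q) ≡ multiplicity G (q , p)
multiplicity-flip G p q = multiplicity-cong G (SameType-flip p q)

multiplicity-loop : ∀ {n} (G : Graph n) → LoopFree G → ∀ p → multiplicity G (p , p) ≡ 0
multiplicity-loop []      []          p = refl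
multiplicity-loop (x ∷ G) (x≁loop ∷ lf) p =
  trans (multiplicity-∷ x G (p , p)) (cong₂ _+_ (χ-no _ not-loop) (multiplicity-loop G lf p))
  where
  not-loop : ¬ SameType (p , p) x
  not-loop (inj₁ (refl , refl)) = x≁loop refl
  not-loop (inj₂ (refl , refl)) = x≁loop refl

multiplicity-lookup : ∀ {n} (G : Graph n) k → 1 ≤ multiplicity G (lookup G k)
multiplicity-lookup (x ∷ G) zero =
  subst (1 ≤_) (sym (multiplicity-∷ x G x))
    (subst (λ c → 1 ≤ c + multiplicity G x) (sym (χ-yes (sameType? x x) (SameType-refl x))) (s≤s z≤n))
multiplicity-lookup (x ∷ G) (suc k) =
  subst (1 ≤_) (sym (multiplicity-∷ x G (lookup G k))) (≤-trans (multiplicity-lookup G k) (m≤n+m _ _))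

edge-of-type : ∀ {n} (G : Graph n) (p q : Fin n) → 1 ≤ multiplicity G (p , q) →
  ∃[ j ] ∃[ t ] orient t (lookup G j) ≡ (p , q)
edge-of-type (x ∷ G) p q 1≤m = here-or-later (sameType? (p , q) x) (subst (1 ≤_) (multiplicity-∷ x G (p , q)) 1≤m)
  where
  here-or-later : (d : Dec (SameType (p , q) x)) → 1 ≤ χ d + multiplicity G (p , q) →
    ∃[ j ] ∃[ t ] orient t (lookup (x ∷ G) j) ≡ (p , q)
  here-or-later (yes (inj₁ (refl , refl))) _ = zero , false , refl
  here-or-later (yes (inj₂ (refl , refl))) _ = zero , true , refl
  here-or-later (no _) 1≤m′ with edge-of-type G p q 1≤m′
  ... | j , t , e = suc j , t , e

simple⇒multiplicity≤1 : ∀ {n} (H : Graph n) → SimpleGraph H → ∀ p q → multiplicity H (p , q) ≤ 1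
simple⇒multiplicity≤1 H simple p q with multiplicity H (p , q) in eq
... | zero  = z≤n
... | suc _ with edge-of-type H p q (subst (1 ≤_) (sym eq) (s≤s z≤n))
...   | j , t , oriented =
  ≤-reflexive (trans (sym eq) (trans (multiplicity-cong H (SameType-of-orient oriented))
                                     (proj₂ (All.lookup simple (∈-lookup j)))))

ind≡χ : ∀ {n} (u v : Fin n) → ind u v ≡ χ (u ≟ᶠ v)
ind≡χ u v with u ≟ᶠ v
... | yes _ = refl
... | no  _ = refl

∑-ind : ∀ {n} (a : Fin n) → ∑[ p < n ] ind a p ≡ 1
∑-ind a = trans (sum-cong-≗ (λ p → trans (ind≡χ a p) (χ-cong sym sym (a ≟ᶠ p) (p ≟ᶠ a)))) (∑-indicator a)

∑-sameType : ∀ {n} (v s t : Fin n) → s ≢ t → ∑[ q < n ] sameTypeχ (v , q) (s , t) ≡ ind s v + ind t v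
∑-sameType v s t s≢t rewrite ind≡χ s v | ind≡χ t v with s ≟ᶠ v | t ≟ᶠ v
... | yes refl | yes refl = ⊥-elim (s≢t refl)
... | yes refl | no t≢v   = trans (sum-cong-≗ (λ q → χ-cong to (λ { refl → inj₁ (refl , refl) }) _ (q ≟ᶠ t))) (∑-indicator t)
  where
  to : ∀ {q} → SameType (v , q) (v , t) → q ≡ t
  to (inj₁ (_ , q≡t)) = q≡t
  to (inj₂ (v≡t , _)) = ⊥-elim (t≢v (sym v≡t))
... | no s≢v   | yes refl = trans (sum-cong-≗ (λ q → χ-cong to (λ { refl → inj₂ (refl , refl) }) _ (q ≟ᶠ s))) (∑-indicator s)
  where
  to : ∀ {q} → SameType (v , q) (s , v) → q ≡ s
  to (inj₁ (v≡s , _)) = ⊥-elim (s≢v (sym v≡s))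
  to (inj₂ (_ , q≡s)) = q≡s
... | no s≢v   | no t≢v   =
  ∑-zero {f = λ q → sameTypeχ (v , q) (s , t)} (λ q → χ-no _ (¬SameType-fst (s≢v ∘ sym) (t≢v ∘ sym)))

∑∑-sameType : ∀ {n} {s t : Fin n} → s ≢ t → ∑∑ (λ p q → sameTypeχ (p , q) (s , t)) ≡ 2
∑∑-sameType {s = s} {t} s≢t =
  trans (sum-cong-≗ (λ p → ∑-sameType p s t s≢t))
        (trans (∑-distrib-+ (ind s) (ind t)) (cong₂ _+_ (∑-ind s) (∑-ind t)))

degree≡∑multiplicity : ∀ {n} (G : Graph n) → LoopFree G → ∀ v → degree G v ≡ ∑[ q < n ] multiplicity G (v , q)
degree≡∑multiplicity {n} [] [] v = sym (∑-zero {n} (λ _ → refl))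
degree≡∑multiplicity ((s , t) ∷ G) (s≢t ∷ lf) v = sym (begin
  ∑[ q < _ ] multiplicity ((s , t) ∷ G) (v , q)
    ≡⟨ sum-cong-≗ (λ q → multiplicity-∷ (s , t) G (v , q)) ⟩
  ∑[ q < _ ] (sameTypeχ (v , q) (s , t) + multiplicity G (v , q))
    ≡⟨ ∑-distrib-+ (λ q → sameTypeχ (v , q) (s , t)) (λ q → multiplicity G (v , q)) ⟩
  ∑[ q < _ ] sameTypeχ (v , q) (s , t) + ∑[ q < _ ] multiplicity G (v , q)
    ≡⟨ cong₂ _+_ (∑-sameType v s t s≢t) (sym (degree≡∑multiplicity G lf v)) ⟩
  ind s v + ind t v + degree G v ∎)
  where open ≡-Reasoning

simpleEdge? : ∀ {n} (G : Graph n) → Decidable (SimpleEdge G)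
simpleEdge? G (u , v) = ¬? (u ≟ᶠ v) ×-dec (multiplicity G (u , v) ≟ 1)

simpleGraph? : ∀ {n} (G : Graph n) → Dec (SimpleGraph G)
simpleGraph? G = All.all? (simpleEdge? G) G

multiplicity-removeTwo : ∀ {n} (G : Graph n) {i j : Fin (length G)} → i ≢ j → ∀ e →
  sameTypeχ e (lookup G i) + sameTypeχ e (lookup G j) + multiplicity (removeTwo G i j) e ≡ multiplicity G e
multiplicity-removeTwo G {i} {j} i≢j e = begin
  w (lookup G i) + w (lookup G j) + count (sameType? e) (removeTwo G i j)
    ≡⟨ cong (w (lookup G i) + w (lookup G j) +_) (count≡sum (sameType? e) (removeTwo G i j)) ⟩
  w (lookup G i) + w (lookup G j) + sum (map w (removeTwo G i j))
    ≡⟨ sum-map-removeTwo w G i≢j ⟩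
  sum (map w G)
    ≡⟨ count≡sum (sameType? e) G ⟨
  count (sameType? e) G ∎
  where
  open ≡-Reasoning
  w : Edge _ → ℕ
  w = sameTypeχ e

endpoint-weight : ∀ {n} → Fin n → Edge n → ℕ
endpoint-weight v (p , q) = ind p v + ind q v

endpoint-weight-orient : ∀ {n} (v : Fin n) (s : Bool) (e : Edge n) →
  endpoint-weight v (orient s e) ≡ endpoint-weight v e
endpoint-weight-orient v false e       = refl
endpoint-weight-orient v true  (p , q) = +-comm (ind q v) (ind p v)

module DoubleEdgeSwap {n} (G : Graph n) {i j : Fin (length G)} (i≢j : i ≢ j) {s t : Bool} {a b u x : Fin n}
                      (Gi : orient s (lookup G i) ≡ (a , b)) (Gj : orient t (lookup G j) ≡ (u , x)) where

  swapped : Graph n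
  swapped = (b , u) ∷ (x , a) ∷ removeTwo G i j

  swap-preserves-degree : ∀ v → degree swapped v ≡ degree G v
  swap-preserves-degree v = begin
    (ind b v + ind u v) + ((ind x v + ind a v) + degree R v)
      ≡⟨ rearrange (ind a v) (ind b v) (ind u v) (ind x v) (degree R v) ⟩
    (ind a v + ind b v) + (ind u v + ind x v) + degree R v
      ≡⟨ cong₂ (λ y z → y + z + degree R v) (weight Gi) (weight Gj) ⟩
    endpoint-weight v (lookup G i) + endpoint-weight v (lookup G j) + degree R v
      ≡⟨ sum-map-removeTwo (endpoint-weight v) G i≢j ⟩
    degree G v ∎
    where
    open ≡-Reasoning
    R = removeTwo G i j
    rearrange : ∀ a b u x r → (b + u) + ((x + a) + r) ≡ (a + b) + (u + x) + r
    rearrange = solve-∀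
    weight : ∀ {r} {e : Edge n} {c d : Fin n} → orient r e ≡ (c , d) → ind c v + ind d v ≡ endpoint-weight v e
    weight {r} {e} refl = endpoint-weight-orient v r e

  swap-multiplicity : ∀ e →
    sameTypeχ e (a , b) + sameTypeχ e (u , x) + multiplicity swapped e
      ≡ sameTypeχ e (b , u) + sameTypeχ e (x , a) + multiplicity G e
  swap-multiplicity e = begin
    ab + ux + multiplicity swapped e          ≡⟨ cong (ab + ux +_) (trans (multiplicity-∷ (b , u) _ e)
                                                   (cong (bu +_) (multiplicity-∷ (x , a) R e))) ⟩
    ab + ux + (bu + (xa + multiplicity R e))  ≡⟨ rearrange ab ux bu xa (multiplicity R e) ⟩
    bu + xa + (ab + ux + multiplicity R e)    ≡⟨ cong (bu + xa +_) removed ⟩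
    bu + xa + multiplicity G e                ∎
    where
    open ≡-Reasoning
    R = removeTwo G i j
    ab = sameTypeχ e (a , b)
    ux = sameTypeχ e (u , x)
    bu = sameTypeχ e (b , u)
    xa = sameTypeχ e (x , a)
    rearrange : ∀ a b c d r → a + b + (c + (d + r)) ≡ c + d + (a + b + r)
    rearrange = solve-∀
    removed : ab + ux + multiplicity R e ≡ multiplicity G e
    removed = trans (cong₂ (λ y z → y + z + multiplicity R e)
                      (sameTypeχ-congʳ e (SameType-of-orient Gi)) (sameTypeχ-congʳ e (SameType-of-orient Gj)))
                    (multiplicity-removeTwo G i≢j e)

∣1+m-n∣≡1+∣m-n∣ : ∀ {m n} → n ≤ m → ∣ suc m - n ∣ ≡ suc ∣ m - n ∣
∣1+m-n∣≡1+∣m-n∣ {m} z≤n     = cong suc (sym (∣-∣-identityʳ m))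
∣1+m-n∣≡1+∣m-n∣ (s≤s n≤m) = ∣1+m-n∣≡1+∣m-n∣ n≤m

m<n⇒1+∣1+m-n∣≡∣m-n∣ : ∀ {m n} → m < n → suc ∣ suc m - n ∣ ≡ ∣ m - n ∣
m<n⇒1+∣1+m-n∣≡∣m-n∣ {zero}  {suc n} _         = refl
m<n⇒1+∣1+m-n∣≡∣m-n∣ {suc m} {suc n} (s≤s m<n) = m<n⇒1+∣1+m-n∣≡∣m-n∣ m<n

∣1+m-n∣≤1+∣m-n∣ : ∀ m n → ∣ suc m - n ∣ ≤ suc ∣ m - n ∣
∣1+m-n∣≤1+∣m-n∣ m       zero    = ≤-reflexive (∣1+m-n∣≡1+∣m-n∣ z≤n)
∣1+m-n∣≤1+∣m-n∣ zero    (suc n) = ≤-trans (n≤1+n n) (n≤1+n (suc n))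
∣1+m-n∣≤1+∣m-n∣ (suc m) (suc n) = ∣1+m-n∣≤1+∣m-n∣ m n

m∸n+n≡n∸m+m : ∀ m n → m ∸ n + n ≡ n ∸ m + m
m∸n+n≡n∸m+m zero    zero    = refl
m∸n+n≡n∸m+m zero    (suc n) = sym (+-identityʳ (suc n))
m∸n+n≡n∸m+m (suc m) zero    = +-identityʳ (suc m)
m∸n+n≡n∸m+m (suc m) (suc n) = trans (+-suc (m ∸ n) n) (trans (cong suc (m∸n+n≡n∸m+m m n)) (sym (+-suc (n ∸ m) m)))

data SwapEffect (m k : ℕ) : ℕ → ℕ → ℕ → ℕ → Set where
  removed₁  : k < m → SwapEffect m k 1 0 0 0
  removed₂  : k < m → SwapEffect m k 0 1 0 0
  added₁    : m < k → SwapEffect m k 0 0 1 0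
  added₂    :         SwapEffect m k 0 0 0 1
  untouched :         SwapEffect m k 0 0 0 0

-- The indicators come first so that, in each case, both sides compute to statements about ∣_-_∣ alone.
SwapEffect-distance : ∀ {m m′ k r₁ r₂ a₁ a₂} → SwapEffect m k r₁ r₂ a₁ a₂ →
  r₁ + r₂ + m′ ≡ a₁ + a₂ + m → r₁ + r₂ + a₁ + ∣ m′ - k ∣ ≤ a₂ + ∣ m - k ∣
SwapEffect-distance (removed₁ (s≤s k≤m′)) refl = ≤-reflexive (sym (∣1+m-n∣≡1+∣m-n∣ k≤m′))
SwapEffect-distance (removed₂ (s≤s k≤m′)) refl = ≤-reflexive (sym (∣1+m-n∣≡1+∣m-n∣ k≤m′))
SwapEffect-distance (added₁ m<k)          refl = ≤-reflexive (m<n⇒1+∣1+m-n∣≡∣m-n∣ m<k)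
SwapEffect-distance {m} {k = k} added₂    refl = ∣1+m-n∣≤1+∣m-n∣ m k
SwapEffect-distance untouched             refl = ≤-refl

-- Descent towards a simple target

module Descent {n : ℕ} (h : Fin n → Fin n → ℕ) (h-sym : ∀ p q → h p q ≡ h q p)
               (h≤1 : ∀ p q → h p q ≤ 1) (h-irrefl : ∀ p → h p p ≡ 0) where

  private
    M : Graph n → Fin n → Fin n → ℕ
    M G p q = multiplicity G (p , q)

  distance : Graph n → ℕ
  distance G = ∑∑ (λ p q → ∣ M G p q - h p q ∣)

  HasTargetDegrees : Graph n → Set
  HasTargetDegrees G = ∀ v → degree G v ≡ ∑[ q < n ] h v q

  Over : Graph n → Fin n → Fin n → Set
  Over G p q = h p q < M G p q

  Under : Graph n → Fin n → Fin n → Set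
  Under G p q = M G p q < h p q

  h-cong : ∀ {p q c d} → SameType (p , q) (c , d) → h p q ≡ h c d
  h-cong (inj₁ (refl , refl)) = refl
  h-cong (inj₂ (refl , refl)) = h-sym _ _

  Over-cong : ∀ G {p q c d} → SameType (p , q) (c , d) → Over G c d → Over G p q
  Over-cong G pq~cd = subst₂ _<_ (sym (h-cong pq~cd)) (sym (multiplicity-cong G pq~cd))

  Under-cong : ∀ G {p q c d} → SameType (p , q) (c , d) → Under G c d → Under G p q
  Under-cong G pq~cd = subst₂ _<_ (sym (multiplicity-cong G pq~cd)) (sym (h-cong pq~cd))

  multiple⇒Over : ∀ G {p q} → 2 ≤ M G p q → Over G p q
  multiple⇒Over G {p} {q} = ≤-trans (s≤s (h≤1 p q))

  Improvement : Graph n → Set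
  Improvement G = ∃[ G′ ] (AdmissibleSwap G G′ × LoopFree G′ × HasTargetDegrees G′ × distance G′ < distance G)

  module Improve (G : Graph n) (lf : LoopFree G) (deg : HasTargetDegrees G)
                 {i j : Fin (length G)} {s t : Bool} {a b u x : Fin n}
                 (Gi : orient s (lookup G i) ≡ (a , b)) (Gj : orient t (lookup G j) ≡ (u , x))
                 (a≢b : a ≢ b) (a≢u : a ≢ u) (a≢x : a ≢ x) (b≢u : b ≢ u) (b≢x : b ≢ x) (u≢x : u ≢ x)
                 (ab-multiple : 2 ≤ M G a b) (ux-over : Over G u x) (bu-under : Under G b u) where

    i≢j : i ≢ j
    i≢j refl = ¬SameType-fst a≢u a≢x
      (SameType-trans (SameType-of-orient Gi) (SameType-sym (SameType-of-orient Gj)))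

    open DoubleEdgeSwap G i≢j Gi Gj

    I : Fin n → Fin n → Edge n → ℕ
    I p q e = sameTypeχ (p , q) e

    effect : ∀ p q → SwapEffect (M G p q) (h p q) (I p q (a , b)) (I p q (u , x)) (I p q (b , u)) (I p q (x , a))
    effect p q with sameType? (p , q) (a , b) | sameType? (p , q) (u , x) | sameType? (p , q) (b , u) | sameType? (p , q) (x , a)
    ... | yes ab | no _   | no _   | no _   = removed₁ (Over-cong G ab (multiple⇒Over G ab-multiple))
    ... | no _   | yes ux | no _   | no _   = removed₂ (Over-cong G ux ux-over)
    ... | no _   | no _   | yes bu | no _   = added₁ (Under-cong G bu bu-under)
    ... | no _   | no _   | no _   | yes _  = added₂
    ... | no _   | no _   | no _   | no _   = untouched
    ... | yes ab | yes ux | _      | _      = ⊥-elim (¬SameType-fst a≢u a≢x (SameType-common ab ux))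
    ... | yes ab | _      | yes bu | _      = ⊥-elim (¬SameType-fst a≢b a≢u (SameType-common ab bu))
    ... | yes ab | _      | _      | yes xa = ⊥-elim (¬SameType-snd b≢x (a≢b ∘ sym) (SameType-common ab xa))
    ... | _      | yes ux | yes bu | _      = ⊥-elim (¬SameType-snd (b≢x ∘ sym) (u≢x ∘ sym) (SameType-common ux bu))
    ... | _      | yes ux | _      | yes xa = ⊥-elim (¬SameType-fst u≢x (a≢u ∘ sym) (SameType-common ux xa))
    ... | _      | _      | yes bu | yes xa = ⊥-elim (¬SameType-fst b≢x (a≢b ∘ sym) (SameType-common bu xa))

    closer : distance swapped < distance G
    closer = ≤-trans (s≤s (m≤n+m (distance swapped) 3)) (≤-pred (≤-pred six+d′≤two+d))
      where
      pointwise : ∀ p q → I p q (a , b) + I p q (u , x) + I p q (b , u) + ∣ M swapped p q - h p q ∣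
                            ≤ I p q (x , a) + ∣ M G p q - h p q ∣
      pointwise p q = SwapEffect-distance (effect p q) (swap-multiplicity (p , q))
      six+d′≤two+d : 2 + 2 + 2 + distance swapped ≤ 2 + distance G
      six+d′≤two+d = begin
        2 + 2 + 2 + distance swapped
          ≡⟨ cong (_+ distance swapped) (cong₂ _+_ (cong₂ _+_ (∑∑-sameType a≢b) (∑∑-sameType u≢x)) (∑∑-sameType b≢u)) ⟨
        ∑∑ (λ p q → I p q (a , b)) + ∑∑ (λ p q → I p q (u , x)) + ∑∑ (λ p q → I p q (b , u)) + distance swapped
          ≡⟨ cong (λ c → c + ∑∑ (λ p q → I p q (b , u)) + distance swapped) (∑∑-distrib-+ (λ p q → I p q (a , b)) _) ⟨
        ∑∑ (λ p q → I p q (a , b) + I p q (u , x)) + ∑∑ (λ p q → I p q (b , u)) + distance swapped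
          ≡⟨ cong (_+ distance swapped) (∑∑-distrib-+ (λ p q → I p q (a , b) + I p q (u , x)) _) ⟨
        ∑∑ (λ p q → I p q (a , b) + I p q (u , x) + I p q (b , u)) + distance swapped
          ≡⟨ ∑∑-distrib-+ (λ p q → I p q (a , b) + I p q (u , x) + I p q (b , u)) _ ⟨
        ∑∑ (λ p q → I p q (a , b) + I p q (u , x) + I p q (b , u) + ∣ M swapped p q - h p q ∣)
          ≤⟨ ∑-mono-≤ (λ p → ∑-mono-≤ (pointwise p)) ⟩
        ∑∑ (λ p q → I p q (x , a) + ∣ M G p q - h p q ∣)
          ≡⟨ ∑∑-distrib-+ (λ p q → I p q (x , a)) (λ p q → ∣ M G p q - h p q ∣) ⟩
        ∑∑ (λ p q → I p q (x , a)) + distance G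
          ≡⟨ cong (_+ distance G) (∑∑-sameType (a≢x ∘ sym)) ⟩
        2 + distance G ∎
        where open ≤-Reasoning

    admissible : AdmissibleSwap G swapped
    admissible = i , j , s , t ,
      subst₂ AdmissibleShape (sym Gi) (sym Gj) (i≢j , (a≢u , a≢x , b≢u , b≢x) , not-both-simple , refl)
      where
      AdmissibleShape : Edge n → Edge n → Set
      AdmissibleShape (v₁ , v₂) (v₃ , v₄) = i ≢ j × Disjoint (v₁ , v₂) (v₃ , v₄)
        × ¬ (SimpleEdge G (lookup G i) × SimpleEdge G (lookup G j))
        × swapped ≡ (v₂ , v₃) ∷ (v₄ , v₁) ∷ removeTwo G i j
      not-both-simple : ¬ (SimpleEdge G (lookup G i) × SimpleEdge G (lookup G j))
      not-both-simple ((_ , simple) , _) =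
        1+n≰n (≤-trans ab-multiple (≤-reflexive (trans (multiplicity-cong G (SameType-of-orient Gi)) simple)))

    improvement : Improvement G
    improvement = swapped , admissible , b≢u ∷ (a≢x ∘ sym) ∷ All-removeTwo lf i j ,
                  (λ v → trans (swap-preserves-degree v) (deg v)) , closer

  module _ (G : Graph n) (lf : LoopFree G) (deg : HasTargetDegrees G) where

    surplus : Fin n → ℕ
    surplus v = ∑[ q < n ] (M G v q ∸ h v q)

    deficit : Fin n → ℕ
    deficit v = ∑[ q < n ] (h v q ∸ M G v q)

    surplus≡deficit : ∀ v → surplus v ≡ deficit v
    surplus≡deficit v = +-cancelʳ-≡ (∑[ q < n ] h v q) (surplus v) (deficit v) (begin
      surplus v + ∑[ q < n ] h v q               ≡⟨ ∑-distrib-+ (λ q → M G v q ∸ h v q) (h v) ⟨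
      ∑[ q < n ] (M G v q ∸ h v q + h v q)       ≡⟨ sum-cong-≗ (λ q → m∸n+n≡n∸m+m (M G v q) (h v q)) ⟩
      ∑[ q < n ] (h v q ∸ M G v q + M G v q)     ≡⟨ ∑-distrib-+ (λ q → h v q ∸ M G v q) (M G v) ⟩
      deficit v + ∑[ q < n ] M G v q             ≡⟨ cong (deficit v +_) (trans (sym (degree≡∑multiplicity G lf v)) (deg v)) ⟩
      deficit v + ∑[ q < n ] h v q               ∎)
      where open ≡-Reasoning

    Stuck : Fin n → Fin n → Set
    Stuck a b = ∀ u x → Under G b u → Over G u x → x ≡ a

    stuck-under⇒over : ∀ {a b q} → Stuck a b → Under G b q → Over G a q
    stuck-under⇒over {a} {b} {q} stuck bq-under =
      Over-cong G (SameType-flip a q) (m∸n≢0⇒n<m ((<⇒≢ 0<surplus) ∘ sym))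
      where
      surplus≡qa-term : surplus q ≡ M G q a ∸ h q a
      surplus≡qa-term = ∑-supported a (λ x x≢a → m≤n⇒m∸n≡0 (≮⇒≥ (x≢a ∘ stuck q x bq-under)))
      0<surplus : 0 < M G q a ∸ h q a
      0<surplus = begin-strict
        0                   <⟨ m<n⇒0<n∸m (Under-cong G (SameType-flip q b) bq-under) ⟩
        h q b ∸ M G q b     ≤⟨ term≤∑ (λ x → h q x ∸ M G q x) b ⟩
        deficit q           ≡⟨ surplus≡deficit q ⟨
        surplus q           ≡⟨ surplus≡qa-term ⟩
        M G q a ∸ h q a     ∎
        where open ≤-Reasoning

    stuck⇒deficit<surplus : ∀ {a b} → Over G a b → Stuck a b → deficit b < surplus a
    stuck⇒deficit<surplus {a} {b} ab-over stuck = begin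
      1 + deficit b                                    ≡⟨ cong (_+ deficit b) (∑-indicator b) ⟨
      ∑[ q < n ] χ (q ≟ᶠ b) + deficit b                ≡⟨ ∑-distrib-+ (λ q → χ (q ≟ᶠ b)) (λ q → h b q ∸ M G b q) ⟨
      ∑[ q < n ] (χ (q ≟ᶠ b) + (h b q ∸ M G b q))      ≤⟨ ∑-mono-≤ pointwise ⟩
      surplus a                                        ∎
      where
      open ≤-Reasoning
      pointwise : ∀ q → χ (q ≟ᶠ b) + (h b q ∸ M G b q) ≤ M G a q ∸ h a q
      pointwise q with q ≟ᶠ b
      ... | yes refl rewrite h-irrefl q | 0∸n≡0 (M G q q) = m<n⇒0<n∸m ab-over
      ... | no _ with M G b q <? h b q
      ...   | yes bq-under = ≤-trans (≤-trans (m∸n≤m (h b q) (M G b q)) (h≤1 b q)) (m<n⇒0<n∸m (stuck-under⇒over stuck bq-under))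
      ...   | no ¬under    = ≤-trans (≤-reflexive (m≤n⇒m∸n≡0 (≮⇒≥ ¬under))) z≤n

    improve-from : ∀ {i s a b} → orient s (lookup G i) ≡ (a , b) → a ≢ b → 2 ≤ M G a b → Improvement G ⊎ Stuck a b
    improve-from {i} {s} {a} {b} Gi a≢b ab-multiple
      with any? (λ u → any? (λ x → (M G b u <? h b u) ×-dec (h u x <? M G u x) ×-dec ¬? (x ≟ᶠ a)))
    ... | no none = inj₂ (λ u x bu-under ux-over →
                      decidable-stable (x ≟ᶠ a) (λ x≢a → none (u , x , bu-under , ux-over , x≢a)))
    ... | yes (u , x , bu-under , ux-over , x≢a) =
      inj₁ (Improve.improvement G lf deg Gi (proj₂ (proj₂ ux-edge)) a≢b a≢u (x≢a ∘ sym) b≢u b≢x u≢x ab-multiple ux-over bu-under)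
      where
      ux-edge = edge-of-type G u x (≤-trans (s≤s z≤n) ux-over)
      a≢u : a ≢ u
      a≢u refl = <⇒≱ bu-under (≤-trans (h≤1 b a) (≤-trans (n≤1+n 1) (subst (2 ≤_) (multiplicity-flip G a b) ab-multiple)))
      b≢u : b ≢ u
      b≢u refl = <⇒≱ bu-under (≤-trans (≤-reflexive (h-irrefl b)) z≤n)
      b≢x : b ≢ x
      b≢x refl = <-asym bu-under (Over-cong G (SameType-flip b u) ux-over)
      u≢x : u ≢ x
      u≢x refl = <⇒≱ ux-over (≤-trans (≤-reflexive (multiplicity-loop G lf u)) z≤n)

    improve : ¬ SimpleGraph G → Improvement G
    improve ¬simple = either (improve-from {k} {false} refl a≢b ab-multiple) (improve-from {k} {true} refl (a≢b ∘ sym) ba-multiple)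
      where
      bad = All.¬All⇒Any¬ (simpleEdge? G) G ¬simple
      k = Any.index bad
      a = proj₁ (lookup G k)
      b = proj₂ (lookup G k)
      a≢b : a ≢ b
      a≢b = All.lookup lf (∈-lookup k)
      ab-multiple : 2 ≤ M G a b
      ab-multiple = ≤∧≢⇒< (multiplicity-lookup G k) (λ 1≡m → Any.lookup-index bad (a≢b , sym 1≡m))
      ba-multiple : 2 ≤ M G b a
      ba-multiple = subst (2 ≤_) (multiplicity-flip G a b) ab-multiple
      either : Improvement G ⊎ Stuck a b → Improvement G ⊎ Stuck b a → Improvement G
      either (inj₁ better) _           = better
      either (inj₂ _)      (inj₁ better) = better
      either (inj₂ stuck-ab) (inj₂ stuck-ba) = ⊥-elim (<-asym
        (subst (deficit b <_) (surplus≡deficit a) (stuck⇒deficit<surplus (multiple⇒Over G ab-multiple) stuck-ab))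
        (subst (deficit a <_) (surplus≡deficit b) (stuck⇒deficit<surplus (multiple⇒Over G ba-multiple) stuck-ba)))

  simplify : ∀ G → LoopFree G → HasTargetDegrees G → Acc _<_ (distance G) → ∃[ G′ ] (SwapReachable G G′ × SimpleGraph G′)
  simplify G lf deg (acc smaller) with simpleGraph? G
  ... | yes simple = G , ε , simple
  ... | no ¬simple with improve G lf deg ¬simple
  ...   | G′ , swap , lf′ , deg′ , closer with simplify G′ lf′ deg′ (smaller closer)
  ...     | G″ , swaps , simple = G″ , swap ◅ swaps , simple

-- Relabelling along equal degree sequences

lookup-tabulate-cast : ∀ {A : Set} {n} (f : Fin n → A) (k : Fin (length (tabulate f))) →
  lookup (tabulate f) k ≡ f (cast (length-tabulate f) k)
lookup-tabulate-cast {n = suc n} f zero    = refl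
lookup-tabulate-cast {n = suc n} f (suc k) = lookup-tabulate-cast (f ∘ suc) k

tabulate-↭-relabelling : ∀ {A : Set} {m n} (f : Fin m → A) (g : Fin n → A) →
  SetoidPermutation._↭_ (≡.setoid A) (tabulate g) (tabulate f) →
  Σ[ σ ∈ Perm.Permutation n m ] ∀ v → f (σ ⟨$⟩ʳ v) ≡ g v
tabulate-↭-relabelling {A} f g g↭f = σ , relabels
  where
  π = Homogeneous.onIndices g↭f
  σ = Perm.cast-id (sym (length-tabulate g)) Perm.∘ₚ π Perm.∘ₚ Perm.cast-id (length-tabulate f)
  relabels : ∀ v → f (σ ⟨$⟩ʳ v) ≡ g v
  relabels v = begin
    f (σ ⟨$⟩ʳ v)                         ≡⟨ lookup-tabulate-cast f (π ⟨$⟩ʳ k) ⟨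
    lookup (tabulate f) (π ⟨$⟩ʳ k)       ≡⟨ SetoidPermutationProperties.onIndices-lookup (≡.setoid A) g↭f k ⟨
    lookup (tabulate g) k                ≡⟨ lookup-tabulate-cast g k ⟩
    g (cast (length-tabulate g) k)       ≡⟨ cong g (cast-involutive (length-tabulate g) (sym (length-tabulate g)) v) ⟩
    g v ∎
    where
    open ≡-Reasoning
    k = cast (sym (length-tabulate g)) v

degree-relabelling : ∀ {m n} (H : Graph m) (G : Graph n) → degreeSequence H ≡ degreeSequence G →
  Σ[ σ ∈ Perm.Permutation n m ] ∀ v → degree H (σ ⟨$⟩ʳ v) ≡ degree G v
degree-relabelling {m} {n} H G same = tabulate-↭-relabelling (degree H) (degree G) (begin
  tabulate (degree G)                 ≡⟨ map-tabulate (λ v → v) (degree G) ⟨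
  map (degree G) (allFin n)           ↭⟨ sort-↭ₛ (map (degree G) (allFin n)) ⟨
  degreeSequence G                    ≡⟨ same ⟨
  degreeSequence H                    ↭⟨ sort-↭ₛ (map (degree H) (allFin m)) ⟩
  map (degree H) (allFin m)           ≡⟨ map-tabulate (λ v → v) (degree H) ⟩
  tabulate (degree H)                 ∎)
  where
  open SortingAlgorithm mergeSort using (sort-↭ₛ)
  open SetoidPermutation (≡.setoid ℕ) using (module PermutationReasoning)
  open PermutationReasoning

module RelabelledAdjacency {m n} (H : Graph m) (H-simple : SimpleGraph H) (σ : Perm.Permutation n m) where

  H-loopFree : LoopFree H
  H-loopFree = All.map proj₁ H-simple

  h : Fin n → Fin n → ℕ
  h p q = multiplicity H (σ ⟨$⟩ʳ p , σ ⟨$⟩ʳ q)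

  h-sym : ∀ p q → h p q ≡ h q p
  h-sym p q = multiplicity-flip H _ _

  h≤1 : ∀ p q → h p q ≤ 1
  h≤1 p q = simple⇒multiplicity≤1 H H-simple _ _

  h-irrefl : ∀ p → h p p ≡ 0
  h-irrefl p = multiplicity-loop H H-loopFree _

  ∑h≡degree : ∀ v → ∑[ q < n ] h v q ≡ degree H (σ ⟨$⟩ʳ v)
  ∑h≡degree v = begin
    ∑[ q < n ] h v q                            ≡⟨ ∑-permute (λ q → multiplicity H (σ ⟨$⟩ʳ v , q)) σ ⟨
    ∑[ q < m ] multiplicity H (σ ⟨$⟩ʳ v , q)    ≡⟨ degree≡∑multiplicity H H-loopFree (σ ⟨$⟩ʳ v) ⟨
    degree H (σ ⟨$⟩ʳ v)                         ∎
    where open ≡-Reasoning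

theorem3p1 : (n : ℕ) (G : Graph n) → LoopFree G → Graphical (degreeSequence G)
    → ∃[ G' ] (SwapReachable G G' × SimpleGraph G')
theorem3p1 n G lf (m , H , H-simple , same-sequence) =
  Descent.simplify h h-sym h≤1 h-irrefl G lf G-degrees (<-wellFounded _)
  where
  relabelling = degree-relabelling H G same-sequence
  open RelabelledAdjacency H H-simple (proj₁ relabelling)
  G-degrees : Descent.HasTargetDegrees h h-sym h≤1 h-irrefl G
  G-degrees v = trans (sym (proj₂ relabelling v)) (sym (∑h≡degree v))
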